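{- Let $q$ be an odd prime power with $q\ge 5$ and let $c\in\mathbb{F}_q^*$. (i) The map $F:\mathbb{F}_q\to\mathbb{F}_q$, $$F(x)=\left(\left(\left(\frac{1}{c^{2}}x\right)^{q-2}+c\right)^{q-2}-\frac{1}{c}\right)^{q-2}+x,$$ has value set $V_F=\{0,-c,-2c\}$; moreover exactly $q-3$ elements of $\mathbb{F}_q$ have no preimage under $F$, exactly $2$ elements have exactly one preimage, exactly one element has exactly $q-2$ preimages, and no element has any other number of preimages. (ii) The map $F:\mathbb{F}_q\to\mathbb{F}_q$, $$F(x)=\left(\left(\left(\frac{ -1}{c^{2}}x\right)^{q-2}+c\right)^{q-2}-\frac{1}{c}\right)^{q-2}+x,$$ has value set $V_F=\mathbb{F}_q\setminus\{c,-c\}$; moreover exactly $2$ elements of $\mathbb{F}_q$ have no preimage, exactly $q-3$ elements have exactly one preimage, exactly one element has exactly $3$ preimages, and no element has any other number of preimages.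
   Context: For $y\in\mathbb{F}_q$, $y^{q-2}$ equals $y^{ -1}$ if $y\neq0$ and $0$ if $y=0$. The value set of $F$ is $V_F=\{F(x):x\in\mathbb{F}_q\}$. -}

module Defs where

open import Level using (0ℓ)
open import Data.Nat as ℕ using (ℕ; zero; suc)
open import Data.Fin using (Fin)
open import Data.List using (List; map; filter; length; allFin)
open import Data.Product using (∃)
open import Relation.Nullary using (¬_)
open import Relation.Unary using (Pred; Decidable)
open import Relation.Binary.PropositionalEquality using (_≡_)
open import Relation.Binary.Definitions using (DecidableEquality)
open import Algebra.Structures using (IsCommutativeRing)
open import Function.Bundles using (_↔_; Inverse)

record FiniteField (q : ℕ) : Set₁ where
  infixl 7 _*_
  infixl 6 _+_
  field
    Carrier : Set
    _+_ _*_ : Carrier → Carrier → Carrier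
    -_ : Carrier → Carrier
    0# 1# : Carrier
    isCommutativeRing : IsCommutativeRing _≡_ _+_ _*_ -_ 0# 1#
    0≢1 : ¬ (0# ≡ 1#)
    inverse : ∀ x → ¬ (x ≡ 0#) → ∃ λ y → x * y ≡ 1#
    _≟_ : DecidableEquality Carrier
    enum : Fin q ↔ Carrier

  _-_ : Carrier → Carrier → Carrier
  x - y = x + (- y)

  _^_ : Carrier → ℕ → Carrier
  x ^ zero = 1#
  x ^ suc n = x * (x ^ n)

  -- y^(q-2): the inverse of y for y ≠ 0, and 0 for y = 0
  inv : Carrier → Carrier
  inv y = y ^ (q ℕ.∸ 2)

  elements : List Carrier
  elements = map (Inverse.to enum) (allFin q)

  countWhere : {P : Pred Carrier 0ℓ} → Decidable P → ℕ
  countWhere P? = length (filter P? elements)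

  preimageCount : (Carrier → Carrier) → Carrier → ℕ
  preimageCount F y = countWhere (λ x → F x ≟ y)

  numWithPreimages : (Carrier → Carrier) → ℕ → ℕ
  numWithPreimages F k = countWhere (λ y → preimageCount F y ℕ.≟ k)

  InValueSet : (Carrier → Carrier) → Carrier → Set
  InValueSet F y = ∃ λ x → F x ≡ y

  F₁ : Carrier → Carrier → Carrier
  F₁ c x = inv (inv (inv ((inv (c * c)) * x) + c) - inv c) + x

  F₂ : Carrier → Carrier → Carrier
  F₂ c x = inv (inv (inv ((- inv (c * c)) * x) + c) - inv c) + x

-- Write F x = φ (a x) + x with φ y = ((y⁻¹ + c)⁻¹ − c⁻¹)⁻¹, where u⁻¹ = u ^ (q − 2) is the
-- inverse of u ≠ 0 by Fermat's little theorem and 0⁻¹ = 0. For y ∉ {0, −c⁻¹} one computes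
-- φ y = −c − c² y, so F x = x − c − c² a x except at x = 0, where F x = 0, and at the pole p
-- with a p = −c⁻¹, where F p = p − c. For a = c⁻² the map is therefore constant −c off {0, −c};
-- for a = −c⁻² it is the bijection x ↦ 2x − c off {0, c}, as 2 ≠ 0 in odd characteristic.
-- Every fibre is then an explicit list or the complement of one, and counting over an
-- enumeration of the field gives the multiplicities.

module Submission where

open import Defs
open import Data.Nat using (ℕ; _≥_; _∸_)
open import Data.Nat.DivMod using (_%_)
open import Data.Product using (_×_; _,_)
open import Data.Sum using (_⊎_)
open import Relation.Nullary using (¬_)
open import Relation.Binary.PropositionalEquality using (_≡_)
open import Function.Bundles using (_⇔_)

open import Level using (0ℓ)
open import Data.Nat as ℕ using (suc; _≤_; s≤s)
open import Data.Nat.Properties using (+-suc; m+n∸m≡n; ≤-trans; m≤m+n)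
open import Data.Product using (∃; proj₂)
open import Data.Product.Properties using (≡-dec)
open import Data.Sum using (inj₁; inj₂)
open import Data.Maybe using (just; nothing)
open import Data.Empty using (⊥-elim)
open import Data.List using (List; []; _∷_; map; filter; length; foldr; allFin)
open import Data.List.Properties using (length-map; length-tabulate; filter-≐)
open import Data.List.Membership.Propositional using (_∈_; _∉_)
open import Data.List.Membership.Propositional.Properties
  using (∈-map⁺; ∈-map⁻; ∈-filter⁺; ∈-filter⁻; ∈-allFin)
open import Data.List.Membership.Propositional.Properties.WithK using (unique∧set⇒bag)
open import Data.List.Relation.Binary.BagAndSetEquality using (∼bag⇒↭)
open import Data.List.Relation.Binary.Permutation.Propositional using (_↭_; ↭⇒↭ₛ)
open import Data.List.Relation.Binary.Permutation.Propositional.Properties using (↭-length)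
import Data.List.Relation.Binary.Permutation.Setoid.Properties as PermutationProperties
open import Data.List.Relation.Unary.All using ([]; _∷_)
open import Data.List.Relation.Unary.AllPairs using ([]; _∷_)
open import Data.List.Relation.Unary.Any using (here; there)
open import Data.List.Relation.Unary.Unique.Propositional using (Unique)
import Data.List.Relation.Unary.Unique.Propositional.Properties as Unique
open import Relation.Nullary using (yes; no; ¬?; contradiction)
open import Relation.Unary using (Pred; Decidable)
open import Relation.Unary.Properties using (∁?)
open import Relation.Binary.Definitions using (WeaklyDecidable; DecidableEquality)
open import Relation.Binary.PropositionalEquality
  using (_≢_; refl; sym; trans; cong; cong₂; subst; module ≡-Reasoning)
open import Relation.Binary.PropositionalEquality.Properties using (setoid)
open import Function.Base using (_∘_)
open import Function.Bundles using (mk⇔; Equivalence; Inverse; Injection)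
open import Function.Properties.Inverse using (Inverse⇒Injection)
open import Algebra.Bundles using (CommutativeRing; RawRing)
open import Algebra.Structures using (IsCommutativeRing)
open import Algebra.Solver.Ring.AlmostCommutativeRing
  using (_-Raw-AlmostCommutative⟶_; fromCommutativeRing)

module RingSolver
  {R : Set} {add mul : R → R → R} {neg : R → R} {zero one : R}
  (isCommutativeRing : IsCommutativeRing _≡_ add mul neg zero one) where

  commutativeRing : CommutativeRing 0ℓ 0ℓ
  commutativeRing = record { isCommutativeRing = isCommutativeRing }

  open CommutativeRing commutativeRing
    using (_+_; _*_; -_; _-_; 0#; 1#; +-comm; +-identityˡ; +-identityʳ; -‿inverseʳ;
           ring; semiring; +-commutativeSemigroup)
  open import Algebra.Properties.Ring ring
    using (-‿+-comm; ⁻¹-anti-homo‿-; -0#≈0#; x[y-z]≈xy-xz; [y-z]x≈yx-zx)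
  open import Algebra.Properties.CommutativeSemigroup +-commutativeSemigroup
    using (interchange)
  open import Algebra.Properties.Semiring.Mult.TCOptimised semiring
    using (×-homo-+; ×1-homo-*) renaming (_×_ to _·_)
  open ≡-Reasoning

  private
    [p-r]+[q-s]≡[p+q]-[r+s] : ∀ p q r s → (p - r) + (q - s) ≡ (p + q) - (r + s)
    [p-r]+[q-s]≡[p+q]-[r+s] p q r s = trans (interchange p (- r) q (- s)) (cong ((p + q) +_) (-‿+-comm r s))

    [x+a]-[x+b]≡a-b : ∀ x a b → (x + a) - (x + b) ≡ a - b
    [x+a]-[x+b]≡a-b x a b = begin
      (x + a) - (x + b)   ≡⟨ [p-r]+[q-s]≡[p+q]-[r+s] x a x b ⟨
      (x - x) + (a - b)   ≡⟨ cong (_+ (a - b)) (-‿inverseʳ x) ⟩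
      0# + (a - b)        ≡⟨ +-identityˡ (a - b) ⟩
      a - b               ∎

  -- Coefficients are integers m − n, represented by pairs (m , n) with one component zero:
  -- they map into every commutative ring, and the solver compares normal forms by
  -- reflexivity, so each integer needs a unique representative.
  Coefficient : Set
  Coefficient = ℕ × ℕ

  normalise : ℕ → ℕ → Coefficient
  normalise (suc m) (suc n) = normalise m n
  normalise m       n       = m , n

  ⟦_⟧ : Coefficient → R
  ⟦ m     , 0     ⟧ = m · 1#
  ⟦ 0     , suc n ⟧ = - (suc n · 1#)
  ⟦ suc m , suc n ⟧ = suc m · 1# - suc n · 1#

  ⟦⟧-difference : ∀ m n → ⟦ m , n ⟧ ≡ m · 1# - n · 1#
  ⟦⟧-difference m       0       = sym (trans (cong (m · 1# +_) -0#≈0#) (+-identityʳ _))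
  ⟦⟧-difference 0       (suc n) = sym (+-identityˡ _)
  ⟦⟧-difference (suc m) (suc n) = refl

  normalise-difference : ∀ m n → ⟦ normalise m n ⟧ ≡ m · 1# - n · 1#
  normalise-difference 0       n       = ⟦⟧-difference 0 n
  normalise-difference (suc m) 0       = ⟦⟧-difference (suc m) 0
  normalise-difference (suc m) (suc n) = begin
    ⟦ normalise m n ⟧                 ≡⟨ normalise-difference m n ⟩
    m · 1# - n · 1#                   ≡⟨ [x+a]-[x+b]≡a-b 1# (m · 1#) (n · 1#) ⟨
    (1# + m · 1#) - (1# + n · 1#)     ≡⟨ cong₂ _-_ (×-homo-+ 1# 1 m) (×-homo-+ 1# 1 n) ⟨
    suc m · 1# - suc n · 1#           ∎

  coefficients : RawRing 0ℓ 0ℓ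
  coefficients = record
    { Carrier = Coefficient ; _≈_ = _≡_
    ; _+_ = λ { (a , b) (c , d) → normalise (a ℕ.+ c) (b ℕ.+ d) }
    ; _*_ = λ { (a , b) (c , d) → normalise (a ℕ.* c ℕ.+ b ℕ.* d) (a ℕ.* d ℕ.+ b ℕ.* c) }
    ; -_ = λ { (a , b) → b , a }
    ; 0# = 0 , 0 ; 1# = 1 , 0
    }

  +-homo : ∀ a b c d → ⟦ normalise (a ℕ.+ c) (b ℕ.+ d) ⟧ ≡ ⟦ a , b ⟧ + ⟦ c , d ⟧
  +-homo a b c d = begin
    ⟦ normalise (a ℕ.+ c) (b ℕ.+ d) ⟧                ≡⟨ normalise-difference (a ℕ.+ c) (b ℕ.+ d) ⟩
    (a ℕ.+ c) · 1# - (b ℕ.+ d) · 1#                  ≡⟨ cong₂ _-_ (×-homo-+ 1# a c) (×-homo-+ 1# b d) ⟩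
    (a · 1# + c · 1#) - (b · 1# + d · 1#)            ≡⟨ [p-r]+[q-s]≡[p+q]-[r+s] _ _ _ _ ⟨
    (a · 1# - b · 1#) + (c · 1# - d · 1#)            ≡⟨ cong₂ _+_ (⟦⟧-difference a b) (⟦⟧-difference c d) ⟨
    ⟦ a , b ⟧ + ⟦ c , d ⟧                            ∎

  *-homo : ∀ a b c d →
    ⟦ normalise (a ℕ.* c ℕ.+ b ℕ.* d) (a ℕ.* d ℕ.+ b ℕ.* c) ⟧ ≡ ⟦ a , b ⟧ * ⟦ c , d ⟧
  *-homo a b c d = begin
    ⟦ normalise (a ℕ.* c ℕ.+ b ℕ.* d) (a ℕ.* d ℕ.+ b ℕ.* c) ⟧
      ≡⟨ normalise-difference (a ℕ.* c ℕ.+ b ℕ.* d) (a ℕ.* d ℕ.+ b ℕ.* c) ⟩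
    (a ℕ.* c ℕ.+ b ℕ.* d) · 1# - (a ℕ.* d ℕ.+ b ℕ.* c) · 1#
      ≡⟨ cong₂ _-_ (trans (×-homo-+ 1# (a ℕ.* c) (b ℕ.* d)) (cong₂ _+_ (×1-homo-* a c) (×1-homo-* b d)))
                   (trans (×-homo-+ 1# (a ℕ.* d) (b ℕ.* c)) (cong₂ _+_ (×1-homo-* a d) (×1-homo-* b c))) ⟩
    (A * C + B * D) - (A * D + B * C)   ≡⟨ cong (λ t → (A * C + B * D) - t) (+-comm (A * D) (B * C)) ⟩
    (A * C + B * D) - (B * C + A * D)   ≡⟨ [p-r]+[q-s]≡[p+q]-[r+s] _ _ _ _ ⟨
    (A * C - B * C) + (B * D - A * D)   ≡⟨ cong ((A * C - B * C) +_) (⁻¹-anti-homo‿- (A * D) (B * D)) ⟨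
    (A * C - B * C) - (A * D - B * D)   ≡⟨ cong₂ _-_ ([y-z]x≈yx-zx C A B) ([y-z]x≈yx-zx D A B) ⟨
    (A - B) * C - (A - B) * D           ≡⟨ x[y-z]≈xy-xz (A - B) C D ⟨
    (A - B) * (C - D)                   ≡⟨ cong₂ _*_ (⟦⟧-difference a b) (⟦⟧-difference c d) ⟨
    ⟦ a , b ⟧ * ⟦ c , d ⟧               ∎
    where A = a · 1#; B = b · 1#; C = c · 1#; D = d · 1#

  -‿homo : ∀ a b → ⟦ b , a ⟧ ≡ - ⟦ a , b ⟧
  -‿homo a b = begin
    ⟦ b , a ⟧              ≡⟨ ⟦⟧-difference b a ⟩
    b · 1# - a · 1#        ≡⟨ ⁻¹-anti-homo‿- (a · 1#) (b · 1#) ⟨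
    - (a · 1# - b · 1#)    ≡⟨ cong -_ (⟦⟧-difference a b) ⟨
    - ⟦ a , b ⟧            ∎

  morphism : coefficients -Raw-AlmostCommutative⟶ fromCommutativeRing commutativeRing
  morphism = record
    { ⟦_⟧ = ⟦_⟧
    ; +-homo = λ { (a , b) (c , d) → +-homo a b c d }
    ; *-homo = λ { (a , b) (c , d) → *-homo a b c d }
    ; -‿homo = λ { (a , b) → -‿homo a b }
    ; 0-homo = refl
    ; 1-homo = refl
    }

  ⟦⟧-equal? : WeaklyDecidable (λ p p′ → ⟦ p ⟧ ≡ ⟦ p′ ⟧)
  ⟦⟧-equal? p p′ with ≡-dec ℕ._≟_ ℕ._≟_ p p′
  ... | yes refl = just refl
  ... | no _     = nothing

  open import Algebra.Solver.Ring coefficients (fromCommutativeRing commutativeRing) morphism ⟦⟧-equal? public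
    using (solve; _:=_; _:+_; _:*_; :-_; _:-_; con)

module _ {A : Set} where

  unique-≐⇒↭ : ∀ {xs ys : List A} → Unique xs → Unique ys →
    (∀ {z} → z ∈ xs ⇔ z ∈ ys) → xs ↭ ys
  unique-≐⇒↭ xs! ys! xs≐ys = ∼bag⇒↭ (unique∧set⇒bag xs! ys! xs≐ys)

  unique₂ : ∀ {a b : A} → a ≢ b → Unique (a ∷ b ∷ [])
  unique₂ a≢b = (a≢b ∷ []) ∷ [] ∷ []

  unique₃ : ∀ {a b d : A} → a ≢ b → a ≢ d → b ≢ d → Unique (a ∷ b ∷ d ∷ [])
  unique₃ a≢b a≢d b≢d = (a≢b ∷ a≢d ∷ []) ∷ (b≢d ∷ []) ∷ [] ∷ []

  data Among₂ (u v : A) : A → Set where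
    first   : Among₂ u v u
    second  : Among₂ u v v
    neither : ∀ {x} → x ∉ u ∷ v ∷ [] → Among₂ u v x

  among₂ : DecidableEquality A → ∀ u v x → Among₂ u v x
  among₂ _≟_ u v x with x ≟ u | x ≟ v
  ... | yes refl | _        = first
  ... | no _     | yes refl = second
  ... | no x≢u   | no x≢v   = neither λ { (here x≡u) → x≢u x≡u ; (there (here x≡v)) → x≢v x≡v }

  data Among₃ (u v w : A) : A → Set where
    first  : Among₃ u v w u
    second : Among₃ u v w v
    third  : Among₃ u v w w
    none   : ∀ {x} → x ∉ u ∷ v ∷ w ∷ [] → Among₃ u v w x

  among₃ : DecidableEquality A → ∀ u v w x → Among₃ u v w x
  among₃ _≟_ u v w x with x ≟ u | x ≟ v | x ≟ w
  ... | yes refl | _        | _        = first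
  ... | no _     | yes refl | _        = second
  ... | no _     | no _     | yes refl = third
  ... | no x≢u   | no x≢v   | no x≢w   =
    none λ { (here x≡u) → x≢u x≡u ; (there (here x≡v)) → x≢v x≡v
           ; (there (there (here x≡w))) → x≢w x≡w }

  length-filter-∁ : ∀ {P : Pred A 0ℓ} (P? : Decidable P) xs →
    length (filter P? xs) ℕ.+ length (filter (∁? P?) xs) ≡ length xs
  length-filter-∁ P? []       = refl
  length-filter-∁ P? (x ∷ xs) with P? x
  ... | yes _ = cong suc (length-filter-∁ P? xs)
  ... | no  _ = trans (+-suc _ _) (cong suc (length-filter-∁ P? xs))

  map-↭ : ∀ {f : A → A} {xs} → Unique xs → (∀ {x y} → f x ≡ f y → x ≡ y) →
    (∀ {x} → x ∈ xs → f x ∈ xs) → (∀ {y} → y ∈ xs → ∃ λ x → x ∈ xs × f x ≡ y) →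
    map f xs ↭ xs
  map-↭ {f} xs! f-injective f-into f-onto =
    unique-≐⇒↭ (Unique.map⁺ f-injective xs!) xs! (mk⇔ into onto)
    where
    into : ∀ {y} → y ∈ map f _ → y ∈ _
    into y∈ with ∈-map⁻ f y∈
    ... | x , x∈ , refl = f-into x∈
    onto : ∀ {y} → y ∈ _ → y ∈ map f _
    onto y∈ with f-onto y∈
    ... | x , x∈ , refl = ∈-map⁺ f x∈

module FiniteFieldProperties {q : ℕ} (𝔽 : FiniteField q) where

  open FiniteField 𝔽
  open IsCommutativeRing isCommutativeRing
    using (+-identityˡ; *-assoc; *-comm; *-identityˡ; *-identityʳ; zeroˡ; zeroʳ;
           +-isCommutativeMonoid; *-isCommutativeMonoid)
  open RingSolver isCommutativeRing
    using (commutativeRing; solve; _:=_; _:+_; _:*_; :-_; _:-_; con)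
  open import Algebra.Properties.Ring (CommutativeRing.ring commutativeRing)
    using (+-cancelʳ; +-identityˡ-unique; -‿involutive; -0#≈0#)
  open import Algebra.Properties.Semiring.Mult.TCOptimised (CommutativeRing.semiring commutativeRing)
    using (×-homo-+) renaming (_×_ to _·_)
  open ≡-Reasoning
  open PermutationProperties (setoid Carrier) using (foldr-commMonoid)
  open import Data.List.Membership.DecPropositional _≟_ using (_∈?_)

  ∈-elements : ∀ x → x ∈ elements
  ∈-elements x = subst (_∈ elements) (Inverse.strictlyInverseˡ enum x)
    (∈-map⁺ (Inverse.to enum) (∈-allFin (Inverse.from enum x)))

  elements-unique : Unique elements
  elements-unique = Unique.map⁺ (Injection.injective (Inverse⇒Injection enum)) (Unique.allFin⁺ q)

  length-elements : length elements ≡ q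
  length-elements = trans (length-map _ (allFin q)) (length-tabulate _)

  countWhere-≐ : ∀ {P : Pred Carrier 0ℓ} (P? : Decidable P) {S} → Unique S →
    (∀ x → P x ⇔ x ∈ S) → countWhere P? ≡ length S
  countWhere-≐ P? S! P⇔∈S = ↭-length (unique-≐⇒↭ (Unique.filter⁺ P? elements-unique) S! (mk⇔ to from))
    where
    to : ∀ {x} → x ∈ filter P? elements → x ∈ _
    to {x} x∈ = Equivalence.to (P⇔∈S x) (proj₂ (∈-filter⁻ P? {xs = elements} x∈))
    from : ∀ {x} → x ∈ _ → x ∈ filter P? elements
    from {x} x∈S = ∈-filter⁺ P? (∈-elements x) (Equivalence.from (P⇔∈S x) x∈S)

  countWhere-∁ : ∀ {P : Pred Carrier 0ℓ} (P? : Decidable P) {S} → Unique S →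
    (∀ x → P x ⇔ x ∉ S) → countWhere P? ≡ q ∸ length S
  countWhere-∁ P? {S} S! P⇔∉S = begin
    countWhere P?                      ≡⟨ cong length (filter-≐ P? ∉S? P≐∉S elements) ⟩
    countWhere ∉S?                     ≡⟨ m+n∸m≡n (countWhere ∈S?) (countWhere ∉S?) ⟨
    (countWhere ∈S? ℕ.+ countWhere ∉S?) ∸ countWhere ∈S?
      ≡⟨ cong₂ _∸_ (trans (length-filter-∁ ∈S? elements) length-elements)
                   (countWhere-≐ ∈S? S! (λ _ → mk⇔ (λ x∈ → x∈) (λ x∈ → x∈))) ⟩
    q ∸ length S                       ∎
    where
    ∈S? = λ x → x ∈? S
    ∉S? = ∁? ∈S?
    P≐∉S = (λ {x} → Equivalence.to (P⇔∉S x)) , (λ {x} → Equivalence.from (P⇔∉S x))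

  *-cancelˡ : ∀ {a x y} → a ≢ 0# → a * x ≡ a * y → x ≡ y
  *-cancelˡ {a} {x} {y} a≢0 ax≡ay with inverse a a≢0
  ... | b , ab≡1 = begin
    x              ≡⟨ *-identityˡ x ⟨
    1# * x         ≡⟨ cong (_* x) ba≡1 ⟨
    b * a * x      ≡⟨ *-assoc b a x ⟩
    b * (a * x)    ≡⟨ cong (b *_) ax≡ay ⟩
    b * (a * y)    ≡⟨ *-assoc b a y ⟨
    b * a * y      ≡⟨ cong (_* y) ba≡1 ⟩
    1# * y         ≡⟨ *-identityˡ y ⟩
    y              ∎
    where ba≡1 = trans (*-comm b a) ab≡1

  *-nonzero : ∀ {a b} → a ≢ 0# → b ≢ 0# → a * b ≢ 0#
  *-nonzero {a} a≢0 b≢0 ab≡0 = b≢0 (*-cancelˡ a≢0 (trans ab≡0 (sym (zeroʳ a))))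

  -‿nonzero : ∀ {x} → x ≢ 0# → - x ≢ 0#
  -‿nonzero {x} x≢0 -x≡0 = x≢0 (trans (sym (-‿involutive x)) (trans (cong -_ -x≡0) -0#≈0#))

  nonzeroElements : List Carrier
  nonzeroElements = filter (λ x → ¬? (x ≟ 0#)) elements

  ∈-nonzeroElements : ∀ {x} → x ≢ 0# → x ∈ nonzeroElements
  ∈-nonzeroElements {x} = ∈-filter⁺ (λ x → ¬? (x ≟ 0#)) (∈-elements x)

  nonzeroElements-nonzero : ∀ {x} → x ∈ nonzeroElements → x ≢ 0#
  nonzeroElements-nonzero = proj₂ ∘ ∈-filter⁻ (λ x → ¬? (x ≟ 0#)) {xs = elements}

  length-nonzeroElements : length nonzeroElements ≡ q ∸ 1
  length-nonzeroElements = countWhere-∁ (λ x → ¬? (x ≟ 0#)) ([] ∷ [])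
    (λ x → mk⇔ (λ { x≢0 (here x≡0) → x≢0 x≡0 }) (λ x∉ x≡0 → x∉ (here x≡0)))

  product : List Carrier → Carrier
  product = foldr _*_ 1#

  product-map-* : ∀ a xs → product (map (a *_) xs) ≡ a ^ length xs * product xs
  product-map-* a []       = sym (*-identityʳ 1#)
  product-map-* a (x ∷ xs) = begin
    a * x * product (map (a *_) xs)    ≡⟨ cong (a * x *_) (product-map-* a xs) ⟩
    a * x * (a ^ length xs * product xs)
      ≡⟨ solve 4 (λ a x aⁿ p → a :* x :* (aⁿ :* p) := a :* aⁿ :* (x :* p))
                 refl a x (a ^ length xs) (product xs) ⟩
    a * a ^ length xs * (x * product xs) ∎

  product-nonzero : ∀ {xs} → (∀ {x} → x ∈ xs → x ≢ 0#) → product xs ≢ 0#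
  product-nonzero {[]}     _       = 0≢1 ∘ sym
  product-nonzero {x ∷ xs} nonzero = *-nonzero (nonzero (here refl)) (product-nonzero (nonzero ∘ there))

  -- x ↦ a * x permutes the nonzero elements, so it leaves their product unchanged.
  ^[q∸1]≡1 : ∀ {a} → a ≢ 0# → a ^ (q ∸ 1) ≡ 1#
  ^[q∸1]≡1 {a} a≢0 with inverse a a≢0
  ... | b , ab≡1 = *-cancelˡ (product-nonzero nonzeroElements-nonzero) (begin
    P * a ^ (q ∸ 1)                         ≡⟨ cong (λ n → P * a ^ n) length-nonzeroElements ⟨
    P * a ^ length nonzeroElements          ≡⟨ *-comm P _ ⟩
    a ^ length nonzeroElements * P          ≡⟨ product-map-* a nonzeroElements ⟨
    product (map (a *_) nonzeroElements)    ≡⟨ foldr-commMonoid *-isCommutativeMonoid (↭⇒↭ₛ a*-permutes) ⟩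
    P                                       ≡⟨ *-identityʳ P ⟨
    P * 1#                                  ∎)
    where
    P = product nonzeroElements
    b≢0 : b ≢ 0#
    b≢0 b≡0 = 0≢1 (trans (sym (zeroʳ a)) (trans (cong (a *_) (sym b≡0)) ab≡1))
    a*-permutes : map (a *_) nonzeroElements ↭ nonzeroElements
    a*-permutes = map-↭ (Unique.filter⁺ _ elements-unique) (*-cancelˡ a≢0)
      (λ x∈ → ∈-nonzeroElements (*-nonzero a≢0 (nonzeroElements-nonzero x∈)))
      (λ {y} y∈ → b * y , ∈-nonzeroElements (*-nonzero b≢0 (nonzeroElements-nonzero y∈)) ,
        trans (sym (*-assoc a b y)) (trans (cong (_* y) ab≡1) (*-identityˡ y)))

  -- For q = 2 we would have inv 0# = 0# ^ 0 = 1#.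
  module _ (3≤q : 3 ≤ q) where

    *-invʳ : ∀ {x} → x ≢ 0# → x * inv x ≡ 1#
    *-invʳ {x} x≢0 = subst (λ n → x ^ n ≡ 1#) (suc[n∸2]≡n∸1 3≤q) (^[q∸1]≡1 x≢0)
      where
      suc[n∸2]≡n∸1 : ∀ {n} → 3 ≤ n → n ∸ 1 ≡ suc (n ∸ 2)
      suc[n∸2]≡n∸1 (s≤s (s≤s (s≤s _))) = refl

    inv-0 : inv 0# ≡ 0#
    inv-0 = 0^[n∸2] 3≤q
      where
      0^[n∸2] : ∀ {n} → 3 ≤ n → 0# ^ (n ∸ 2) ≡ 0#
      0^[n∸2] (s≤s (s≤s (s≤s _))) = zeroˡ _

    inv-unique : ∀ {x y} → x * y ≡ 1# → inv x ≡ y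
    inv-unique {x} {y} xy≡1 = begin
      inv x              ≡⟨ *-identityʳ (inv x) ⟨
      inv x * 1#         ≡⟨ cong (inv x *_) xy≡1 ⟨
      inv x * (x * y)    ≡⟨ *-assoc (inv x) x y ⟨
      inv x * x * y      ≡⟨ cong (_* y) (trans (*-comm (inv x) x) (*-invʳ x≢0)) ⟩
      1# * y             ≡⟨ *-identityˡ y ⟩
      y                  ∎
      where
      x≢0 : x ≢ 0#
      x≢0 x≡0 = 0≢1 (trans (sym (zeroˡ y)) (trans (cong (_* y) (sym x≡0)) xy≡1))

    inv-nonzero : ∀ {x} → x ≢ 0# → inv x ≢ 0#
    inv-nonzero {x} x≢0 inv≡0 = 0≢1 (trans (sym (zeroʳ x)) (trans (cong (x *_) (sym inv≡0)) (*-invʳ x≢0)))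

    inv-involutive : ∀ x → inv (inv x) ≡ x
    inv-involutive x with x ≟ 0#
    ... | yes refl = trans (cong inv inv-0) inv-0
    ... | no  x≢0  = inv-unique (trans (*-comm (inv x) x) (*-invʳ x≢0))

    inv-‿-comm : ∀ x → inv (- x) ≡ - inv x
    inv-‿-comm x with x ≟ 0#
    ... | yes refl = trans (cong inv -0#≈0#) (trans inv-0 (trans (sym -0#≈0#) (cong -_ (sym inv-0))))
    ... | no  x≢0  = inv-unique (trans (solve 2 (λ x y → (:- x) :* (:- y) := x :* y) refl x (inv x)) (*-invʳ x≢0))

  sum : List Carrier → Carrier
  sum = foldr _+_ 0#

  sum-map-+1 : ∀ xs → sum (map (_+ 1#) xs) ≡ length xs · 1# + sum xs
  sum-map-+1 []       = sym (+-identityˡ 0#)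
  sum-map-+1 (x ∷ xs) = begin
    (x + 1#) + sum (map (_+ 1#) xs)       ≡⟨ cong ((x + 1#) +_) (sum-map-+1 xs) ⟩
    (x + 1#) + (length xs · 1# + sum xs)
      ≡⟨ solve 3 (λ x n s → (x :+ con (1 , 0)) :+ (n :+ s) := (con (1 , 0) :+ n) :+ (x :+ s))
                 refl x (length xs · 1#) (sum xs) ⟩
    (1# + length xs · 1#) + (x + sum xs)  ≡⟨ cong (_+ (x + sum xs)) (×-homo-+ 1# 1 (length xs)) ⟨
    suc (length xs) · 1# + (x + sum xs)   ∎

  -- Summing x + 1 over all x gives back the sum of all elements.
  q·1≡0 : q · 1# ≡ 0#
  q·1≡0 = +-identityˡ-unique (q · 1#) (sum elements) (begin
    q · 1# + sum elements                      ≡⟨ cong (λ n → n · 1# + sum elements) length-elements ⟨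
    length elements · 1# + sum elements        ≡⟨ sum-map-+1 elements ⟨
    sum (map (_+ 1#) elements)                 ≡⟨ foldr-commMonoid +-isCommutativeMonoid (↭⇒↭ₛ +1-permutes) ⟩
    sum elements                               ∎)
    where
    +1-permutes : map (_+ 1#) elements ↭ elements
    +1-permutes = map-↭ elements-unique (+-cancelʳ 1# _ _) (λ {x} _ → ∈-elements (x + 1#))
      (λ {y} _ → y - 1# , ∈-elements (y - 1#) , solve 1 (λ y → (y :- con (1 , 0)) :+ con (1 , 0) := y) refl y)

  odd·1≡1 : 1# + 1# ≡ 0# → ∀ n → n % 2 ≡ 1 → n · 1# ≡ 1#
  odd·1≡1 2≡0 1             _       = refl
  odd·1≡1 2≡0 (suc (suc n)) n%2≡1   = begin
    (2 ℕ.+ n) · 1#       ≡⟨ ×-homo-+ 1# 2 n ⟩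
    (1# + 1#) + n · 1#   ≡⟨ cong₂ _+_ 2≡0 (odd·1≡1 2≡0 n n%2≡1) ⟩
    0# + 1#              ≡⟨ +-identityˡ 1# ⟩
    1#                   ∎

  1+1≢0 : q % 2 ≡ 1 → 1# + 1# ≢ 0#
  1+1≢0 q-odd 2≡0 = 0≢1 (trans (sym q·1≡0) (odd·1≡1 2≡0 q q-odd))

module Corollary4 {q : ℕ} (q-odd : q % 2 ≡ 1) (5≤q : 5 ≤ q) (𝔽 : FiniteField q)
  (c : FiniteField.Carrier 𝔽) (c≢0 : c ≢ FiniteField.0# 𝔽) where

  open FiniteField 𝔽 hiding (_-_)
  open FiniteFieldProperties 𝔽
  open RingSolver isCommutativeRing using (commutativeRing; solve; _:=_; _:+_; _:*_; :-_; _:-_; con)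
  open CommutativeRing commutativeRing using (_-_)
  open IsCommutativeRing isCommutativeRing
    using (+-identityˡ; +-identityʳ; -‿inverseˡ; -‿inverseʳ; *-comm; zeroʳ)
  open import Algebra.Properties.Ring (CommutativeRing.ring commutativeRing)
    using (-‿+-comm; -‿injective; +-identityˡ-unique; +-cancelʳ)
  open ≡-Reasoning

  3≤q : 3 ≤ q
  3≤q = ≤-trans (m≤m+n 3 2) 5≤q

  φ : Carrier → Carrier
  φ y = inv (inv (inv y + c) - inv c)

  φ-0 : φ 0# ≡ 0#
  φ-0 = begin
    inv (inv (inv 0# + c) - inv c)   ≡⟨ cong (λ t → inv (inv (t + c) - inv c)) (inv-0 3≤q) ⟩
    inv (inv (0# + c) - inv c)       ≡⟨ cong (λ t → inv (inv t - inv c)) (+-identityˡ c) ⟩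
    inv (inv c - inv c)              ≡⟨ cong inv (-‿inverseʳ (inv c)) ⟩
    inv 0#                           ≡⟨ inv-0 3≤q ⟩
    0#                               ∎

  φ-pole : φ (- inv c) ≡ - c
  φ-pole = begin
    inv (inv (inv (- inv c) + c) - inv c)   ≡⟨ cong (λ t → inv (inv (t + c) - inv c)) inv-[-inv-c] ⟩
    inv (inv (- c + c) - inv c)             ≡⟨ cong (λ t → inv (inv t - inv c)) (-‿inverseˡ c) ⟩
    inv (inv 0# - inv c)                    ≡⟨ cong (λ t → inv (t - inv c)) (inv-0 3≤q) ⟩
    inv (0# - inv c)                        ≡⟨ cong inv (+-identityˡ (- inv c)) ⟩
    inv (- inv c)                           ≡⟨ inv-[-inv-c] ⟩
    - c                                     ∎
    where
    inv-[-inv-c] : inv (- inv c) ≡ - c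
    inv-[-inv-c] = trans (inv-‿-comm 3≤q (inv c)) (cong -_ (inv-involutive 3≤q c))

  -- With u = y⁻¹ and s = u + c the claim reads (s⁻¹ − c⁻¹) · (−c y s) = 1, as c y s = c + c² y.
  φ-regular : ∀ {y} → y ≢ 0# → y ≢ - inv c → φ y ≡ - (c + c * c * y)
  φ-regular {y} y≢0 y≢pole = inv-unique 3≤q (begin
    (w - v) * - (c + c * c * y)
      ≡⟨ solve 5 (λ w v c y u → (w :- v) :* (:- (c :+ c :* c :* y))
                   := (v :* c) :* (con (1 , 0) :+ c :* y) :- ((u :+ c) :* w) :* (c :* y)
                      :- w :* c :* (con (1 , 0) :- y :* u)) refl w v c y u ⟩
    ((v * c) * (1# + c * y) - (s * w) * (c * y)) - w * c * (1# - y * u)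
      ≡⟨ cong₂ (λ t t′ → (t * (1# + c * y) - t′ * (c * y)) - w * c * (1# - y * u))
               (trans (*-comm v c) (*-invʳ 3≤q c≢0)) (*-invʳ 3≤q s≢0) ⟩
    (1# * (1# + c * y) - 1# * (c * y)) - w * c * (1# - y * u)
      ≡⟨ cong (λ t → (1# * (1# + c * y) - 1# * (c * y)) - w * c * (1# - t)) (*-invʳ 3≤q y≢0) ⟩
    (1# * (1# + c * y) - 1# * (c * y)) - w * c * (1# - 1#)
      ≡⟨ solve 3 (λ w c y → (con (1 , 0) :* (con (1 , 0) :+ c :* y) :- con (1 , 0) :* (c :* y))
                             :- w :* c :* (con (1 , 0) :- con (1 , 0)) := con (1 , 0)) refl w c y ⟩
    1#   ∎)
    where
    u = inv y
    s = u + c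
    w = inv s
    v = inv c
    s≢0 : s ≢ 0#
    s≢0 s≡0 = y≢pole (begin
      y             ≡⟨ inv-involutive 3≤q y ⟨
      inv u         ≡⟨ cong inv (solve 2 (λ u c → u := (u :+ c) :- c) refl u c) ⟩
      inv (s - c)   ≡⟨ cong (λ t → inv (t - c)) s≡0 ⟩
      inv (0# - c)  ≡⟨ cong inv (+-identityˡ (- c)) ⟩
      inv (- c)     ≡⟨ inv-‿-comm 3≤q c ⟩
      - inv c       ∎)

  -- F₁ c and F₂ c are definitionally F (inv (c * c)) and F (- inv (c * c)).
  F : Carrier → Carrier → Carrier
  F a x = φ (a * x) + x

  F-0 : ∀ a → F a 0# ≡ 0#
  F-0 a = begin
    φ (a * 0#) + 0#   ≡⟨ cong (λ t → φ t + 0#) (zeroʳ a) ⟩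
    φ 0# + 0#         ≡⟨ +-identityʳ (φ 0#) ⟩
    φ 0#              ≡⟨ φ-0 ⟩
    0#                ∎

  F-pole : ∀ {a p} → a * p ≡ - inv c → F a p ≡ - c + p
  F-pole {p = p} ap≡pole = cong (_+ p) (trans (cong φ ap≡pole) φ-pole)

  F-regular : ∀ {a p x} → a ≢ 0# → a * p ≡ - inv c → x ∉ 0# ∷ p ∷ [] →
    F a x ≡ x - (c + (c * c * a) * x)
  F-regular {a} {p} {x} a≢0 ap≡pole x∉ = begin
    φ (a * x) + x                 ≡⟨ cong (_+ x) (φ-regular (*-nonzero a≢0 (x∉ ∘ here)) ax≢pole) ⟩
    - (c + c * c * (a * x)) + x
      ≡⟨ solve 3 (λ c a x → :- (c :+ c :* c :* (a :* x)) :+ x := x :- (c :+ (c :* c :* a) :* x)) refl c a x ⟩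
    x - (c + (c * c * a) * x)     ∎
    where
    ax≢pole : a * x ≢ - inv c
    ax≢pole ax≡pole = x∉ (there (here (*-cancelˡ a≢0 (trans ax≡pole (sym ap≡pole)))))

  a : Carrier
  a = inv (c * c)

  c*c≢0 : c * c ≢ 0#
  c*c≢0 = *-nonzero c≢0 c≢0

  c*c*a≡1 : c * c * a ≡ 1#
  c*c*a≡1 = *-invʳ 3≤q c*c≢0

  a*c≡inv-c : a * c ≡ inv c
  a*c≡inv-c = sym (inv-unique 3≤q (trans (solve 2 (λ c a → c :* (a :* c) := c :* c :* a) refl c a) c*c*a≡1))

  a≢0 : a ≢ 0#
  a≢0 = inv-nonzero 3≤q c*c≢0

  c+c≢0 : c + c ≢ 0#
  c+c≢0 c+c≡0 = *-nonzero (1+1≢0 q-odd) c≢0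
    (trans (solve 1 (λ c → (con (1 , 0) :+ con (1 , 0)) :* c := c :+ c) refl c) c+c≡0)

  c≢-c : c ≢ - c
  c≢-c c≡-c = c+c≢0 (trans (cong (c +_) c≡-c) (-‿inverseʳ c))

  0≢c : 0# ≢ c
  0≢c = c≢0 ∘ sym

  0≢-c : 0# ≢ - c
  0≢-c = -‿nonzero c≢0 ∘ sym

  0∉±c : 0# ∉ c ∷ - c ∷ []
  0∉±c (here 0≡c)          = 0≢c 0≡c
  0∉±c (there (here 0≡-c)) = 0≢-c 0≡-c

  q∸2≡3+q∸5 : q ∸ 2 ≡ 3 ℕ.+ (q ∸ 5)
  q∸2≡3+q∸5 = n∸2≡3+n∸5 5≤q
    where
    n∸2≡3+n∸5 : ∀ {n} → 5 ≤ n → n ∸ 2 ≡ 3 ℕ.+ (n ∸ 5)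
    n∸2≡3+n∸5 (s≤s (s≤s (s≤s (s≤s (s≤s _))))) = refl

  q∸2≢0 : q ∸ 2 ≢ 0
  q∸2≢0 q∸2≡0 = contradiction (trans (sym q∸2≡3+q∸5) q∸2≡0) λ ()

  q∸2≢1 : q ∸ 2 ≢ 1
  q∸2≢1 q∸2≡1 = contradiction (trans (sym q∸2≡3+q∸5) q∸2≡1) λ ()

  a*[-c]≡pole : a * (- c) ≡ - inv c
  a*[-c]≡pole = trans (solve 2 (λ a c → a :* (:- c) := :- (a :* c)) refl a c) (cong -_ a*c≡inv-c)

  F₁-0 : F₁ c 0# ≡ 0#
  F₁-0 = F-0 a

  F₁-pole : F₁ c (- c) ≡ - (c + c)
  F₁-pole = trans (F-pole a*[-c]≡pole) (-‿+-comm c c)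

  F₁-regular : ∀ {x} → x ∉ 0# ∷ - c ∷ [] → F₁ c x ≡ - c
  F₁-regular {x} x∉ = begin
    F a x                       ≡⟨ F-regular a≢0 a*[-c]≡pole x∉ ⟩
    x - (c + (c * c * a) * x)   ≡⟨ cong (λ t → x - (c + t * x)) c*c*a≡1 ⟩
    x - (c + 1# * x)            ≡⟨ solve 2 (λ x c → x :- (c :+ con (1 , 0) :* x) := :- c) refl x c ⟩
    - c                         ∎

  0≢-2c : 0# ≢ - (c + c)
  0≢-2c = -‿nonzero c+c≢0 ∘ sym

  -c≢-2c : - c ≢ - (c + c)
  -c≢-2c -c≡-2c = c≢0 (+-identityˡ-unique c c (sym (-‿injective -c≡-2c)))

  F₁-image : ∀ x → F₁ c x ∈ 0# ∷ - c ∷ - (c + c) ∷ []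
  F₁-image x with among₂ _≟_ 0# (- c) x
  ... | first      = here F₁-0
  ... | second     = there (there (here F₁-pole))
  ... | neither x∉ = there (here (F₁-regular x∉))

  fibre₁-0 : preimageCount (F₁ c) 0# ≡ 1
  fibre₁-0 = countWhere-≐ _ ([] ∷ []) λ x → mk⇔ (to x) λ { (here refl) → F₁-0 }
    where
    to : ∀ x → F₁ c x ≡ 0# → x ∈ 0# ∷ []
    to x F₁x≡0 with among₂ _≟_ 0# (- c) x
    ... | first      = here refl
    ... | second     = ⊥-elim (0≢-2c (trans (sym F₁x≡0) F₁-pole))
    ... | neither x∉ = ⊥-elim (0≢-c (trans (sym F₁x≡0) (F₁-regular x∉)))

  fibre₁-c : preimageCount (F₁ c) (- c) ≡ q ∸ 2
  fibre₁-c = countWhere-∁ _ (unique₂ 0≢-c) λ x → mk⇔ (to x) F₁-regular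
    where
    to : ∀ x → F₁ c x ≡ - c → x ∉ 0# ∷ - c ∷ []
    to x F₁x≡-c (here refl)         = 0≢-c (trans (sym F₁-0) F₁x≡-c)
    to x F₁x≡-c (there (here refl)) = -c≢-2c (trans (sym F₁x≡-c) F₁-pole)

  fibre₁-2c : preimageCount (F₁ c) (- (c + c)) ≡ 1
  fibre₁-2c = countWhere-≐ _ ([] ∷ []) λ x → mk⇔ (to x) λ { (here refl) → F₁-pole }
    where
    to : ∀ x → F₁ c x ≡ - (c + c) → x ∈ - c ∷ []
    to x F₁x≡-2c with among₂ _≟_ 0# (- c) x
    ... | first      = ⊥-elim (0≢-2c (trans (sym F₁-0) F₁x≡-2c))
    ... | second     = here refl
    ... | neither x∉ = ⊥-elim (-c≢-2c (trans (sym (F₁-regular x∉)) F₁x≡-2c))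

  fibre₁-other : ∀ {y} → y ∉ 0# ∷ - c ∷ - (c + c) ∷ [] → preimageCount (F₁ c) y ≡ 0
  fibre₁-other {y} y∉ = countWhere-≐ _ [] λ x →
    mk⇔ (λ F₁x≡y → ⊥-elim (y∉ (subst (_∈ _) F₁x≡y (F₁-image x)))) λ ()

  preimages₁ : ∀ y →
    preimageCount (F₁ c) y ≡ 0 ⊎ preimageCount (F₁ c) y ≡ 1 ⊎ preimageCount (F₁ c) y ≡ q ∸ 2
  preimages₁ y with among₃ _≟_ 0# (- c) (- (c + c)) y
  ... | first      = inj₂ (inj₁ fibre₁-0)
  ... | second     = inj₂ (inj₂ fibre₁-c)
  ... | third      = inj₂ (inj₁ fibre₁-2c)
  ... | none y∉    = inj₁ (fibre₁-other y∉)

  valueSet₁ : ∀ y → InValueSet (F₁ c) y ⇔ (y ≡ 0# ⊎ y ≡ - c ⊎ y ≡ - (c + c))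
  valueSet₁ y = mk⇔ to from
    where
    to : InValueSet (F₁ c) y → y ≡ 0# ⊎ y ≡ - c ⊎ y ≡ - (c + c)
    to (x , refl) with F₁-image x
    ... | here F₁x≡0                   = inj₁ F₁x≡0
    ... | there (here F₁x≡-c)          = inj₂ (inj₁ F₁x≡-c)
    ... | there (there (here F₁x≡-2c)) = inj₂ (inj₂ F₁x≡-2c)
    from : y ≡ 0# ⊎ y ≡ - c ⊎ y ≡ - (c + c) → InValueSet (F₁ c) y
    from (inj₁ refl)        = 0# , F₁-0
    from (inj₂ (inj₁ refl)) = c , F₁-regular λ
      { (here c≡0) → c≢0 c≡0 ; (there (here c≡-c)) → c≢-c c≡-c }
    from (inj₂ (inj₂ refl)) = - c , F₁-pole

  withPreimages₁-0 : numWithPreimages (F₁ c) 0 ≡ q ∸ 3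
  withPreimages₁-0 = countWhere-∁ _ (unique₃ 0≢-c 0≢-2c -c≢-2c) λ y → mk⇔ (to y) fibre₁-other
    where
    to : ∀ y → preimageCount (F₁ c) y ≡ 0 → y ∉ 0# ∷ - c ∷ - (c + c) ∷ []
    to y #≡0 (here refl)                 = contradiction (trans (sym fibre₁-0) #≡0) λ ()
    to y #≡0 (there (here refl))         = q∸2≢0 (trans (sym fibre₁-c) #≡0)
    to y #≡0 (there (there (here refl))) = contradiction (trans (sym fibre₁-2c) #≡0) λ ()

  withPreimages₁-1 : numWithPreimages (F₁ c) 1 ≡ 2
  withPreimages₁-1 = countWhere-≐ _ (unique₂ 0≢-2c) λ y → mk⇔ (to y) λ
    { (here refl) → fibre₁-0 ; (there (here refl)) → fibre₁-2c }
    where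
    to : ∀ y → preimageCount (F₁ c) y ≡ 1 → y ∈ 0# ∷ - (c + c) ∷ []
    to y #≡1 with among₃ _≟_ 0# (- c) (- (c + c)) y
    ... | first      = here refl
    ... | second     = ⊥-elim (q∸2≢1 (trans (sym fibre₁-c) #≡1))
    ... | third      = there (here refl)
    ... | none y∉    = contradiction (trans (sym (fibre₁-other y∉)) #≡1) λ ()

  withPreimages₁-q∸2 : numWithPreimages (F₁ c) (q ∸ 2) ≡ 1
  withPreimages₁-q∸2 = countWhere-≐ _ ([] ∷ []) λ y → mk⇔ (to y) λ { (here refl) → fibre₁-c }
    where
    to : ∀ y → preimageCount (F₁ c) y ≡ q ∸ 2 → y ∈ - c ∷ []
    to y #≡q∸2 with among₃ _≟_ 0# (- c) (- (c + c)) y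
    ... | first      = ⊥-elim (q∸2≢1 (trans (sym #≡q∸2) fibre₁-0))
    ... | second     = here refl
    ... | third      = ⊥-elim (q∸2≢1 (trans (sym #≡q∸2) fibre₁-2c))
    ... | none y∉    = ⊥-elim (q∸2≢0 (trans (sym #≡q∸2) (fibre₁-other y∉)))

  [-a]*c≡pole : (- a) * c ≡ - inv c
  [-a]*c≡pole = trans (solve 2 (λ a c → (:- a) :* c := :- (a :* c)) refl a c) (cong -_ a*c≡inv-c)

  line : Carrier → Carrier
  line x = (x + x) - c

  line⁻¹ : Carrier → Carrier
  line⁻¹ y = inv (1# + 1#) * (y + c)

  line-line⁻¹ : ∀ y → line (line⁻¹ y) ≡ y
  line-line⁻¹ y = begin
    (h * (y + c) + h * (y + c)) - c
      ≡⟨ solve 3 (λ h y c → (h :* (y :+ c) :+ h :* (y :+ c)) :- c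
                            := ((con (1 , 0) :+ con (1 , 0)) :* h) :* (y :+ c) :- c) refl h y c ⟩
    ((1# + 1#) * h) * (y + c) - c     ≡⟨ cong (λ t → t * (y + c) - c) (*-invʳ 3≤q (1+1≢0 q-odd)) ⟩
    1# * (y + c) - c                  ≡⟨ solve 2 (λ y c → con (1 , 0) :* (y :+ c) :- c := y) refl y c ⟩
    y                                 ∎
    where h = inv (1# + 1#)

  line-injective : ∀ {x x′} → line x ≡ line x′ → x ≡ x′
  line-injective {x} {x′} lx≡lx′ = *-cancelˡ (1+1≢0 q-odd) (begin
    (1# + 1#) * x   ≡⟨ solve 1 (λ x → (con (1 , 0) :+ con (1 , 0)) :* x := x :+ x) refl x ⟩
    x + x           ≡⟨ +-cancelʳ (- c) (x + x) (x′ + x′) lx≡lx′ ⟩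
    x′ + x′         ≡⟨ solve 1 (λ x → (con (1 , 0) :+ con (1 , 0)) :* x := x :+ x) refl x′ ⟨
    (1# + 1#) * x′  ∎)

  line-0 : line 0# ≡ - c
  line-0 = solve 1 (λ c → (con (0 , 0) :+ con (0 , 0)) :- c := :- c) refl c

  line-c : line c ≡ c
  line-c = solve 1 (λ c → (c :+ c) :- c := c) refl c

  F₂-0 : F₂ c 0# ≡ 0#
  F₂-0 = F-0 (- a)

  F₂-pole : F₂ c c ≡ 0#
  F₂-pole = trans (F-pole [-a]*c≡pole) (-‿inverseˡ c)

  F₂-regular : ∀ {x} → x ∉ 0# ∷ c ∷ [] → F₂ c x ≡ line x
  F₂-regular {x} x∉ = begin
    F (- a) x                                ≡⟨ F-regular (-‿nonzero a≢0) [-a]*c≡pole x∉ ⟩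
    x - (c + (c * c * (- a)) * x)
      ≡⟨ solve 3 (λ x c a → x :- (c :+ (c :* c :* (:- a)) :* x)
                            := ((x :+ x) :- c) :+ (c :* c :* a :- con (1 , 0)) :* x) refl x c a ⟩
    ((x + x) - c) + (c * c * a - 1#) * x     ≡⟨ cong (λ t → ((x + x) - c) + (t - 1#) * x) c*c*a≡1 ⟩
    ((x + x) - c) + (1# - 1#) * x
      ≡⟨ solve 2 (λ x c → ((x :+ x) :- c) :+ (con (1 , 0) :- con (1 , 0)) :* x := (x :+ x) :- c) refl x c ⟩
    line x                                   ∎

  line-avoids : ∀ {x} → x ∉ 0# ∷ c ∷ [] → line x ∉ c ∷ - c ∷ []
  line-avoids x∉ (here lx≡c)         = x∉ (there (here (line-injective (trans lx≡c (sym line-c)))))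
  line-avoids x∉ (there (here lx≡-c)) = x∉ (here (line-injective (trans lx≡-c (sym line-0))))

  line⁻¹-regular : ∀ {y} → y ≢ c → y ≢ - c → line⁻¹ y ∉ 0# ∷ c ∷ []
  line⁻¹-regular {y} y≢c y≢-c (here ≡0) =
    y≢-c (trans (sym (line-line⁻¹ y)) (trans (cong line ≡0) line-0))
  line⁻¹-regular {y} y≢c y≢-c (there (here ≡c)) =
    y≢c (trans (sym (line-line⁻¹ y)) (trans (cong line ≡c) line-c))

  F₂-line⁻¹ : ∀ {y} → y ≢ c → y ≢ - c → F₂ c (line⁻¹ y) ≡ y
  F₂-line⁻¹ {y} y≢c y≢-c = trans (F₂-regular (line⁻¹-regular y≢c y≢-c)) (line-line⁻¹ y)

  F₂-image : ∀ x → F₂ c x ∉ c ∷ - c ∷ []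
  F₂-image x with among₂ _≟_ 0# c x
  ... | first      = subst (_∉ _) (sym F₂-0) 0∉±c
  ... | second     = subst (_∉ _) (sym F₂-pole) 0∉±c
  ... | neither x∉ = subst (_∉ _) (sym (F₂-regular x∉)) (line-avoids x∉)

  F₂-regular-fibre : ∀ {x y} → x ∉ 0# ∷ c ∷ [] → F₂ c x ≡ y → x ≡ line⁻¹ y
  F₂-regular-fibre {x} {y} x∉ F₂x≡y = line-injective (begin
    line x             ≡⟨ F₂-regular x∉ ⟨
    F₂ c x             ≡⟨ F₂x≡y ⟩
    y                  ≡⟨ line-line⁻¹ y ⟨
    line (line⁻¹ y)    ∎)

  fibre₂-0 : preimageCount (F₂ c) 0# ≡ 3
  fibre₂-0 = countWhere-≐ _ (unique₃ 0≢c (line⁻¹0∉ ∘ here ∘ sym) (line⁻¹0∉ ∘ there ∘ here ∘ sym))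
    λ x → mk⇔ (to x) λ
      { (here refl) → F₂-0 ; (there (here refl)) → F₂-pole
      ; (there (there (here refl))) → F₂-line⁻¹ 0≢c 0≢-c }
    where
    line⁻¹0∉ : line⁻¹ 0# ∉ 0# ∷ c ∷ []
    line⁻¹0∉ = line⁻¹-regular 0≢c 0≢-c
    to : ∀ x → F₂ c x ≡ 0# → x ∈ 0# ∷ c ∷ line⁻¹ 0# ∷ []
    to x F₂x≡0 with among₂ _≟_ 0# c x
    ... | first      = here refl
    ... | second     = there (here refl)
    ... | neither x∉ = there (there (here (F₂-regular-fibre x∉ F₂x≡0)))

  fibre₂-avoided : ∀ {y} → y ∈ c ∷ - c ∷ [] → preimageCount (F₂ c) y ≡ 0
  fibre₂-avoided y∈ = countWhere-≐ _ [] λ x →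
    mk⇔ (λ F₂x≡y → ⊥-elim (F₂-image x (subst (_∈ _) (sym F₂x≡y) y∈))) λ ()

  fibre₂-other : ∀ {y} → y ∉ 0# ∷ c ∷ - c ∷ [] → preimageCount (F₂ c) y ≡ 1
  fibre₂-other {y} y∉ = countWhere-≐ _ ([] ∷ []) λ x → mk⇔ (to x) λ
    { (here refl) → F₂-line⁻¹ (y∉ ∘ there ∘ here) (y∉ ∘ there ∘ there ∘ here) }
    where
    to : ∀ x → F₂ c x ≡ y → x ∈ line⁻¹ y ∷ []
    to x F₂x≡y with among₂ _≟_ 0# c x
    ... | first      = ⊥-elim (y∉ (here (trans (sym F₂x≡y) F₂-0)))
    ... | second     = ⊥-elim (y∉ (here (trans (sym F₂x≡y) F₂-pole)))
    ... | neither x∉ = here (F₂-regular-fibre x∉ F₂x≡y)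

  preimages₂ : ∀ y →
    preimageCount (F₂ c) y ≡ 0 ⊎ preimageCount (F₂ c) y ≡ 1 ⊎ preimageCount (F₂ c) y ≡ 3
  preimages₂ y with among₃ _≟_ 0# c (- c) y
  ... | first      = inj₂ (inj₂ fibre₂-0)
  ... | second     = inj₁ (fibre₂-avoided (here refl))
  ... | third      = inj₁ (fibre₂-avoided (there (here refl)))
  ... | none y∉    = inj₂ (inj₁ (fibre₂-other y∉))

  valueSet₂ : ∀ y → InValueSet (F₂ c) y ⇔ (¬ (y ≡ c) × ¬ (y ≡ - c))
  valueSet₂ y = mk⇔
    (λ { (x , refl) → F₂-image x ∘ here , F₂-image x ∘ there ∘ here })
    (λ { (y≢c , y≢-c) → line⁻¹ y , F₂-line⁻¹ y≢c y≢-c })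

  withPreimages₂-0 : numWithPreimages (F₂ c) 0 ≡ 2
  withPreimages₂-0 = countWhere-≐ _ (unique₂ c≢-c) λ y → mk⇔ (to y) fibre₂-avoided
    where
    to : ∀ y → preimageCount (F₂ c) y ≡ 0 → y ∈ c ∷ - c ∷ []
    to y #≡0 with among₃ _≟_ 0# c (- c) y
    ... | first      = contradiction (trans (sym fibre₂-0) #≡0) λ ()
    ... | second     = here refl
    ... | third      = there (here refl)
    ... | none y∉    = contradiction (trans (sym (fibre₂-other y∉)) #≡0) λ ()

  withPreimages₂-1 : numWithPreimages (F₂ c) 1 ≡ q ∸ 3
  withPreimages₂-1 = countWhere-∁ _ (unique₃ 0≢c 0≢-c c≢-c) λ y → mk⇔ (to y) fibre₂-other
    where
    to : ∀ y → preimageCount (F₂ c) y ≡ 1 → y ∉ 0# ∷ c ∷ - c ∷ []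
    to y #≡1 (here refl)                 = contradiction (trans (sym fibre₂-0) #≡1) λ ()
    to y #≡1 (there (here refl))         = contradiction (trans (sym (fibre₂-avoided (here refl))) #≡1) λ ()
    to y #≡1 (there (there (here refl))) = contradiction (trans (sym (fibre₂-avoided (there (here refl)))) #≡1) λ ()

  withPreimages₂-3 : numWithPreimages (F₂ c) 3 ≡ 1
  withPreimages₂-3 = countWhere-≐ _ ([] ∷ []) λ y → mk⇔ (to y) λ { (here refl) → fibre₂-0 }
    where
    to : ∀ y → preimageCount (F₂ c) y ≡ 3 → y ∈ 0# ∷ []
    to y #≡3 with among₃ _≟_ 0# c (- c) y
    ... | first      = here refl
    ... | second     = contradiction (trans (sym (fibre₂-avoided (here refl))) #≡3) λ ()
    ... | third      = contradiction (trans (sym (fibre₂-avoided (there (here refl)))) #≡3) λ ()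
    ... | none y∉    = contradiction (trans (sym (fibre₂-other y∉)) #≡3) λ ()

corollary4 : (q : ℕ) → q % 2 ≡ 1 → q ≥ 5 → (𝔽 : FiniteField q) →
  let open FiniteField 𝔽 in
  (c : Carrier) → ¬ (c ≡ 0#) →
    ( (∀ y → InValueSet (F₁ c) y ⇔ (y ≡ 0# ⊎ y ≡ - c ⊎ y ≡ - (c + c)))
    × numWithPreimages (F₁ c) 0 ≡ q ∸ 3
    × numWithPreimages (F₁ c) 1 ≡ 2
    × numWithPreimages (F₁ c) (q ∸ 2) ≡ 1
    × (∀ y → preimageCount (F₁ c) y ≡ 0 ⊎ preimageCount (F₁ c) y ≡ 1
             ⊎ preimageCount (F₁ c) y ≡ q ∸ 2) )
    × ( (∀ y → InValueSet (F₂ c) y ⇔ (¬ (y ≡ c) × ¬ (y ≡ - c)))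
    × numWithPreimages (F₂ c) 0 ≡ 2
    × numWithPreimages (F₂ c) 1 ≡ q ∸ 3
    × numWithPreimages (F₂ c) 3 ≡ 1
    × (∀ y → preimageCount (F₂ c) y ≡ 0 ⊎ preimageCount (F₂ c) y ≡ 1
             ⊎ preimageCount (F₂ c) y ≡ 3) )
corollary4 q q-odd 5≤q 𝔽 c c≢0 =
    (valueSet₁ , withPreimages₁-0 , withPreimages₁-1 , withPreimages₁-q∸2 , preimages₁)
  , (valueSet₂ , withPreimages₂-0 , withPreimages₂-1 , withPreimages₂-3 , preimages₂)
  where open Corollary4 q-odd 5≤q 𝔽 c c≢0
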